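{- If $G$ is a $2$-regular graph on $n$ vertices, then \[ \operatorname{xhom}(G,E_2)\le \operatorname{xhom}(C_6,E_2)^{n/6}. \]
   Context: Graphs are finite and simple; $C_6$ is the cycle on 6 vertices. $E_2$ is the graph on two vertices, each carrying a loop, with no other edges. For a graph $G$ and a graph $H$ (possibly with loops), a map $\phi:V(G)\to V(H)$ is an existence homomorphism if for every $v\in V(G)$ there is a neighbor $w$ of $v$ in $G$ with $\phi(v)\phi(w)\in E(H)$; $\operatorname{xhom}(G,H)$ is the number of existence homomorphisms from $G$ to $H$. (Thus an existence homomorphism into $E_2$ is a 2-coloring of $V(G)$ in which every vertex has a neighbor of the same color.) -}

module Defs where

open import Data.Bool using (Bool; true; false; _∧_; _∨_)
open import Data.Bool.Properties using (∨-comm)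
open import Data.Nat using (ℕ; zero; suc; _+_; _%_; _≡ᵇ_)
open import Data.Fin using (Fin; zero; suc; toℕ)
open import Data.List using (List; []; _∷_; [_]; map; concatMap; length; filterᵇ; allFin)
open import Data.Bool.ListAction using (all; any)
open import Relation.Binary.PropositionalEquality using (_≡_; refl)

record Graph (n : ℕ) : Set where
  field
    Adj   : Fin n → Fin n → Bool
    sym   : ∀ i j → Adj i j ≡ Adj j i
    irrefl : ∀ i → Adj i i ≡ false
open Graph public

record LGraph (m : ℕ) : Set where
  field
    LAdj : Fin m → Fin m → Bool
    lsym : ∀ i j → LAdj i j ≡ LAdj j i
open LGraph public

degree : ∀ {n} → Graph n → Fin n → ℕ
degree {n} G i = length (filterᵇ (Adj G i) (allFin n))

IsRegular : ∀ {n} → ℕ → Graph n → Set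
IsRegular k G = ∀ i → degree G i ≡ k

cons : ∀ {n m} → Fin m → (Fin n → Fin m) → Fin (suc n) → Fin m
cons k f zero = k
cons k f (suc i) = f i

allFuns : ∀ n m → List (Fin n → Fin m)
allFuns zero m = [ (λ ()) ]
allFuns (suc n) m = concatMap (λ f → map (λ k → cons k f) (allFin m)) (allFuns n m)

isXhom : ∀ {n m} → Graph n → LGraph m → (Fin n → Fin m) → Bool
isXhom {n} G H φ = all (λ v → any (λ w → Adj G v w ∧ LAdj H (φ v) (φ w)) (allFin n)) (allFin n)

xhom : ∀ {n m} → Graph n → LGraph m → ℕ
xhom {n} {m} G H = length (filterᵇ (isXhom G H) (allFuns n m))

E₂ : LGraph 2
E₂ = record { LAdj = adj ; lsym = s }
  where
  adj : Fin 2 → Fin 2 → Bool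
  adj zero zero = true
  adj (suc zero) (suc zero) = true
  adj _ _ = false
  s : ∀ i j → adj i j ≡ adj j i
  s zero zero = refl
  s zero (suc zero) = refl
  s (suc zero) zero = refl
  s (suc zero) (suc zero) = refl

C₆ : Graph 6
C₆ = record { Adj = adj ; sym = λ i j → ∨-comm (toℕ j ≡ᵇ succ6 i) (toℕ i ≡ᵇ succ6 j) ; irrefl = irr }
  where
  succ6 : Fin 6 → ℕ
  succ6 i = (toℕ i + 1) % 6
  adj : Fin 6 → Fin 6 → Bool
  adj i j = (toℕ j ≡ᵇ succ6 i) ∨ (toℕ i ≡ᵇ succ6 j)
  irr : ∀ i → adj i i ≡ false
  irr zero = refl
  irr (suc zero) = refl
  irr (suc (suc zero)) = refl
  irr (suc (suc (suc zero))) = refl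
  irr (suc (suc (suc (suc zero)))) = refl
  irr (suc (suc (suc (suc (suc zero))))) = refl

module Submission where

-- An existence homomorphism G → E₂ is a 2-colouring in which every vertex is
-- served, i.e. has a neighbour of its own colour.  G is a disjoint union of
-- cycles and the count is multiplicative over them, so everything reduces to:
-- a cycle on k vertices has at most 20 ^ (k / 6) good colourings.

open import Defs hiding (sym)
open import Data.Bool using (Bool; true; false; _∧_; _∨_; not; if_then_else_; T)
open import Data.Bool.Properties using (T?; ∧-comm; ∨-comm; ∨-identityʳ; not-involutive)
open import Data.Bool.ListAction using (all; any)
open import Data.Nat using (ℕ; zero; suc; pred; _+_; _∸_; _*_; _^_; _≤_; _<_; _≤?_; _<?_; s≤s; z≤n; s≤s⁻¹; NonZero)
open import Data.Nat.Properties
  using (*-assoc; *-cancelʳ-≡; *-cancelʳ-≤; *-cancelˡ-≤; *-comm; *-distribʳ-+; *-distribˡ-+; *-identityʳ; *-identityˡ;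
         *-mono-≤; *-monoʳ-≤; *-monoˡ-≤; +-comm; +-identityʳ; +-mono-≤; +-monoʳ-≤; +-monoˡ-≤; +-suc;
         <-cmp; <-irrefl; <-trans; ^-distribˡ-+-*; ^-monoʳ-<; ^-monoˡ-≤; m^n≢0; m∸n+n≡m; m≤m+n; m≤n+m;
         m≤n⇒m<n∨m≡n; m≤n⇒m≤1+n; n<1+n; ≤-antisym; ≤-reflexive; ≤-trans; ≤ᵇ⇒≤; ≮⇒≥; module ≤-Reasoning)
open import Data.Nat.Tactic.RingSolver using (solve-∀)
open import Data.Fin using (Fin; zero; suc; toℕ; fromℕ<)
open import Data.Fin.Properties using (_≟_; any?; all?; pigeonhole; toℕ<n; toℕ-fromℕ<; toℕ-injective; 0≢1+n)
  renaming (suc-injective to fsuc-injective)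
open import Data.List using (List; []; _∷_; map; concatMap; length; filterᵇ; allFin)
open import Data.List.Membership.Propositional using (_∈_; lose)
open import Data.List.Membership.Propositional.Properties using (∈-filter⁺; ∈-filter⁻; ∈-allFin)
open import Data.List.Relation.Unary.All using ([]; _∷_)
open import Data.List.Relation.Unary.AllPairs using ([]; _∷_)
open import Data.List.Relation.Unary.All.Properties using (all⁺; all⁻; tabulate⁺; tabulate⁻)
open import Data.List.Relation.Unary.Any using (here; there; satisfied)
open import Data.List.Relation.Unary.Any.Properties using (any⁺; any⁻)
open import Data.List.Relation.Unary.Unique.Propositional using (Unique)
open import Data.List.Relation.Unary.Unique.Propositional.Properties using (allFin⁺; filter⁺)
open import Data.Product using (Σ; ∃; ∃₂; _×_; _,_; proj₁; proj₂)
open import Data.Sum using (_⊎_; inj₁; inj₂)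
open import Data.Unit using (tt)
open import Data.Empty using (⊥; ⊥-elim)
open import Data.Vec.Functional using (updateAt)
open import Data.Vec.Functional.Properties using (updateAt-updates; updateAt-minimal)
open import Function using (_∘_)
open import Function.Definitions using (Injective)
open import Relation.Nullary using (¬_; yes; no; does)
open import Relation.Nullary.Decidable using (⌊_⌋; True; toWitness; fromWitness)
open import Relation.Unary using (Decidable)
open import Relation.Binary.Definitions using (tri<; tri≈; tri>)
open import Relation.Binary.PropositionalEquality
  using (_≡_; _≢_; refl; sym; trans; cong; cong₂; subst; module ≡-Reasoning)

_⇒_ : Bool → Bool → Bool
a ⇒ b = not a ∨ b

𝟙 : Bool → ℕ
𝟙 b = if b then 1 else 0

T-true : ∀ {b} → T b → b ≡ true
T-true {true} _ = refl

T-ext : ∀ {a b} → (T a → T b) → (T b → T a) → a ≡ b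
T-ext {true}  {true}  _ _ = refl
T-ext {true}  {false} f _ = ⊥-elim (f _)
T-ext {false} {true}  _ g = ⊥-elim (g _)
T-ext {false} {false} _ _ = refl

all-elim : ∀ {n} (p : Fin n → Bool) → T (all p (allFin n)) → ∀ i → T (p i)
all-elim {n} p h = tabulate⁻ (all⁺ p (allFin n) h)

all-intro : ∀ {n} (p : Fin n → Bool) → (∀ i → T (p i)) → T (all p (allFin n))
all-intro p h = all⁻ p (tabulate⁺ h)

any-elim : ∀ {n} (p : Fin n → Bool) → T (any p (allFin n)) → ∃ λ i → T (p i)
any-elim {n} p h = satisfied (any⁻ p (allFin n) h)

any-intro : ∀ {n} (p : Fin n → Bool) i → T (p i) → T (any p (allFin n))
any-intro p i pi = any⁺ p (lose (∈-allFin i) pi)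

all-ext : ∀ {n} (p q : Fin n → Bool) → (∀ i → p i ≡ q i) → all p (allFin n) ≡ all q (allFin n)
all-ext p q p≡q = T-ext (λ h → all-intro q λ i → subst T (p≡q i) (all-elim p h i))
                        (λ h → all-intro p λ i → subst T (sym (p≡q i)) (all-elim q h i))

any-ext : ∀ {n} (p q : Fin n → Bool) → (∀ i → p i ≡ q i) → any p (allFin n) ≡ any q (allFin n)
any-ext p q p≡q = T-ext (λ h → let (i , pi) = any-elim p h in any-intro q i (subst T (p≡q i) pi))
                        (λ h → let (i , qi) = any-elim q h in any-intro p i (subst T (sym (p≡q i)) qi))

⇒-intro : ∀ {a b} → (T a → T b) → T (a ⇒ b)
⇒-intro {false} _ = _
⇒-intro {true}  f = f _

⇒-elim : ∀ {a b} → T (a ⇒ b) → T a → T b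
⇒-elim {true} h _ = h

∧-intro : ∀ {a b} → T a → T b → T (a ∧ b)
∧-intro {true} _ tb = tb

∧-elim : ∀ {a b} → T (a ∧ b) → T a × T b
∧-elim {true} tb = _ , tb

allBelow : ℕ → (ℕ → Bool) → Bool
allBelow zero p = true
allBelow (suc m) p = p 0 ∧ allBelow m (p ∘ suc)

allBelow-ext : ∀ m (p q : ℕ → Bool) → (∀ t → p t ≡ q t) → allBelow m p ≡ allBelow m q
allBelow-ext zero p q p≡q = refl
allBelow-ext (suc m) p q p≡q = cong₂ _∧_ (p≡q 0) (allBelow-ext m (p ∘ suc) (q ∘ suc) (p≡q ∘ suc))

all-allFin-suc : ∀ m (p : Fin (suc m) → Bool) → all p (allFin (suc m)) ≡ p zero ∧ all (p ∘ suc) (allFin m)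
all-allFin-suc m p = T-ext
  (λ h → ∧-intro (all-elim p h zero) (all-intro (p ∘ suc) (all-elim p h ∘ suc)))
  (λ h → all-intro p (both (∧-elim {p zero} h)))
  where
  both : T (p zero) × T (all (p ∘ suc) (allFin m)) → ∀ i → T (p i)
  both (p0 , _) zero = p0
  both (_ , rest) (suc i) = all-elim (p ∘ suc) rest i

all-toℕ : ∀ m (p : ℕ → Bool) → all (p ∘ toℕ) (allFin m) ≡ allBelow m p
all-toℕ zero p = refl
all-toℕ (suc m) p = trans (all-allFin-suc m (p ∘ toℕ)) (cong (p 0 ∧_) (all-toℕ m (p ∘ suc)))

any-filter : ∀ {A : Set} (a q : A → Bool) xs → any (λ y → a y ∧ q y) xs ≡ any q (filterᵇ a xs)
any-filter a q [] = refl
any-filter a q (x ∷ xs) with a x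
... | true  = cong (q x ∨_) (any-filter a q xs)
... | false = any-filter a q xs

Colouring : ℕ → Set
Colouring n = Fin n → Fin 2

c₀ c₁ : Fin 2
c₀ = zero
c₁ = suc zero

-- Two colours are equal exactly when they are adjacent in E₂.
_≈_ : Fin 2 → Fin 2 → Bool
a ≈ b = LAdj E₂ a b

≈-sym : ∀ a b → a ≈ b ≡ b ≈ a
≈-sym = lsym E₂

opposite : Fin 2 → Fin 2
opposite zero = c₁
opposite (suc zero) = c₀

countL : {A : Set} → (A → Bool) → List A → ℕ
countL P [] = 0
countL P (x ∷ xs) = if P x then suc (countL P xs) else countL P xs

length-filter : {A : Set} (P : A → Bool) (xs : List A) → length (filterᵇ P xs) ≡ countL P xs
length-filter P [] = refl
length-filter P (x ∷ xs) with P x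
... | true = cong suc (length-filter P xs)
... | false = length-filter P xs

countL-ext : {A : Set} (P Q : A → Bool) → (∀ x → P x ≡ Q x) → ∀ xs → countL P xs ≡ countL Q xs
countL-ext P Q P≡Q [] = refl
countL-ext P Q P≡Q (x ∷ xs) rewrite P≡Q x with Q x
... | true = cong suc (countL-ext P Q P≡Q xs)
... | false = countL-ext P Q P≡Q xs

countL-mono : ∀ {A : Set} (p q : A → Bool) → (∀ x → T (p x) → T (q x)) → ∀ xs → countL p xs ≤ countL q xs
countL-mono p q p⊆q [] = z≤n
countL-mono p q p⊆q (y ∷ ys) with p y in py | q y in qy
... | true  | true  = s≤s (countL-mono p q p⊆q ys)
... | true  | false = ⊥-elim (subst T qy (p⊆q y (subst T (sym py) _)))
... | false | true  = m≤n⇒m≤1+n (countL-mono p q p⊆q ys)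
... | false | false = countL-mono p q p⊆q ys

countL-strict : ∀ {A : Set} (p q : A → Bool) → (∀ x → T (p x) → T (q x)) →
  ∀ {x} xs → x ∈ xs → T (q x) → ¬ T (p x) → countL p xs < countL q xs
countL-strict p q p⊆q (y ∷ ys) (here refl) qy ¬py with p y in py | q y
... | true  | _     = ⊥-elim (¬py _)
... | false | true  = s≤s (countL-mono p q p⊆q ys)
countL-strict p q p⊆q (y ∷ ys) (there x∈ys) qx ¬px with p y in py | q y in qy
... | true  | true  = s≤s (countL-strict p q p⊆q ys x∈ys qx ¬px)
... | true  | false = ⊥-elim (subst T qy (p⊆q y (subst T (sym py) _)))
... | false | true  = m≤n⇒m≤1+n (countL-strict p q p⊆q ys x∈ys qx ¬px)
... | false | false = countL-strict p q p⊆q ys x∈ys qx ¬px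

#[_] : (n : ℕ) → (Colouring n → Bool) → ℕ
#[ n ] P = countL P (allFuns n 2)

#-ext : ∀ n (P Q : Colouring n → Bool) → (∀ φ → P φ ≡ Q φ) → #[ n ] P ≡ #[ n ] Q
#-ext n P Q P≡Q = countL-ext P Q P≡Q (allFuns n 2)

-- Splitting on the colour of vertex 0 (this is how allFuns enumerates).
#-suc : ∀ n (P : Colouring (suc n) → Bool) →
  #[ suc n ] P ≡ #[ n ] (λ φ → P (cons c₀ φ)) + #[ n ] (λ φ → P (cons c₁ φ))
#-suc n P = go (allFuns n 2)
  where
  go : ∀ fs → countL P (concatMap (λ f → map (λ k → cons k f) (allFin 2)) fs)
              ≡ countL (λ φ → P (cons c₀ φ)) fs + countL (λ φ → P (cons c₁ φ)) fs
  go [] = refl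
  go (f ∷ fs) with P (cons c₀ f) | P (cons c₁ f)
  ... | true  | true  = cong suc (trans (cong suc (go fs)) (sym (+-suc _ _)))
  ... | true  | false = cong suc (go fs)
  ... | false | true  = trans (cong suc (go fs)) (sym (+-suc _ _))
  ... | false | false = go fs

#-true : ∀ n (P : Colouring n → Bool) → (∀ φ → P φ ≡ true) → #[ n ] P ≡ 2 ^ n
#-true zero P always = cong 𝟙 (always _)
#-true (suc n) P always =
  trans (#-suc n P) (trans (cong₂ _+_ (#-true n _ (λ φ → always _)) (#-true n _ (λ φ → always _)))
                            (cong (2 ^ n +_) (sym (+-identityʳ (2 ^ n)))))

#-false : ∀ n (P : Colouring n → Bool) → (∀ φ → P φ ≡ false) → #[ n ] P ≡ 0
#-false zero P never = cong 𝟙 (never _)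
#-false (suc n) P never =
  trans (#-suc n P) (cong₂ _+_ (#-false n _ (λ φ → never _)) (#-false n _ (λ φ → never _)))

#-split : ∀ n (a P : Colouring n → Bool) →
  #[ n ] P ≡ #[ n ] (λ φ → a φ ∧ P φ) + #[ n ] (λ φ → not (a φ) ∧ P φ)
#-split n a P = go (allFuns n 2)
  where
  go : ∀ φs → countL P φs ≡ countL (λ φ → a φ ∧ P φ) φs + countL (λ φ → not (a φ) ∧ P φ) φs
  go [] = refl
  go (φ ∷ φs) with a φ | P φ
  ... | true  | true  = cong suc (go φs)
  ... | true  | false = go φs
  ... | false | true  = trans (cong suc (go φs)) (sym (+-suc _ _))
  ... | false | false = go φs

#-all-c₀ : ∀ k → #[ k ] (λ ψ → all (λ i → ψ i ≈ c₀) (allFin k)) ≡ 1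
#-all-c₀ zero = refl
#-all-c₀ (suc k) =
  trans (#-suc k _)
        (cong₂ _+_ (trans (#-ext k _ _ (λ ψ → all-allFin-suc k (λ i → cons c₀ ψ i ≈ c₀))) (#-all-c₀ k))
                   (#-false k _ (λ _ → refl)))

-- Tests that only look at the values of a colouring (we have no function extensionality).
Extensional : ∀ {n} → (Colouring n → Bool) → Set
Extensional {n} P = ∀ φ ψ → (∀ i → φ i ≡ ψ i) → P φ ≡ P ψ

_[_≔_] : ∀ {n} → Colouring n → Fin n → Fin 2 → Colouring n
φ [ u ≔ b ] = updateAt φ u (λ _ → b)

-- Pinning the colour of one vertex u: every colouring arises from exactly one
-- colouring pinned to c₀ at u and one pinned to c₁ at u.
#-pin : ∀ n (u : Fin n) (P : Colouring n → Bool) → Extensional P →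
  2 * #[ n ] P ≡ #[ n ] (λ φ → P (φ [ u ≔ c₀ ])) + #[ n ] (λ φ → P (φ [ u ≔ c₁ ]))
#-pin (suc n) zero P extP = begin
    2 * #[ suc n ] P                             ≡⟨ cong (2 *_) (#-suc n P) ⟩
    2 * (#[ n ] (P ∘ cons c₀) + #[ n ] (P ∘ cons c₁))
      ≡⟨ double-sum (#[ n ] (P ∘ cons c₀)) (#[ n ] (P ∘ cons c₁)) ⟩
    (#[ n ] (P ∘ cons c₀) + #[ n ] (P ∘ cons c₀)) + (#[ n ] (P ∘ cons c₁) + #[ n ] (P ∘ cons c₁))
      ≡⟨ cong₂ _+_ (sym (pinned c₀)) (sym (pinned c₁)) ⟩
    #[ suc n ] (λ φ → P (φ [ zero ≔ c₀ ])) + #[ suc n ] (λ φ → P (φ [ zero ≔ c₁ ])) ∎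
  where
  open ≡-Reasoning
  double-sum : ∀ a b → 2 * (a + b) ≡ (a + a) + (b + b)
  double-sum = solve-∀
  -- after pinning vertex 0, its original colour is irrelevant
  pinned : ∀ b → #[ suc n ] (λ φ → P (φ [ zero ≔ b ])) ≡ #[ n ] (P ∘ cons b) + #[ n ] (P ∘ cons b)
  pinned b = trans (#-suc n _) (cong₂ _+_ (#-ext n _ _ (same c₀)) (#-ext n _ _ (same c₁)))
    where
    same : ∀ c φ → P (cons c φ [ zero ≔ b ]) ≡ P (cons b φ)
    same c φ = extP _ _ (λ { zero → refl ; (suc i) → refl })
#-pin (suc n) (suc u) P extP = begin
    2 * #[ suc n ] P                             ≡⟨ cong (2 *_) (#-suc n P) ⟩
    2 * (#[ n ] (P ∘ cons c₀) + #[ n ] (P ∘ cons c₁))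
      ≡⟨ *-distribˡ-+ 2 (#[ n ] (P ∘ cons c₀)) (#[ n ] (P ∘ cons c₁)) ⟩
    2 * #[ n ] (P ∘ cons c₀) + 2 * #[ n ] (P ∘ cons c₁)
      ≡⟨ cong₂ _+_ (#-pin n u (P ∘ cons c₀) (extCons c₀)) (#-pin n u (P ∘ cons c₁) (extCons c₁)) ⟩
    (R c₀ c₀ + R c₀ c₁) + (R c₁ c₀ + R c₁ c₁)    ≡⟨ interchange (R c₀ c₀) (R c₀ c₁) (R c₁ c₀) (R c₁ c₁) ⟩
    (R c₀ c₀ + R c₁ c₀) + (R c₀ c₁ + R c₁ c₁)    ≡⟨ cong₂ _+_ (sym (pinned c₀)) (sym (pinned c₁)) ⟩
    #[ suc n ] (λ φ → P (φ [ suc u ≔ c₀ ])) + #[ suc n ] (λ φ → P (φ [ suc u ≔ c₁ ])) ∎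
  where
  open ≡-Reasoning
  interchange : ∀ a b c d → (a + b) + (c + d) ≡ (a + c) + (b + d)
  interchange = solve-∀
  extCons : ∀ c → Extensional (P ∘ cons c)
  extCons c φ ψ φ≗ψ = extP _ _ (λ { zero → refl ; (suc i) → φ≗ψ i })
  R : Fin 2 → Fin 2 → ℕ
  R c b = #[ n ] (λ φ → P (cons c (φ [ u ≔ b ])))
  pinned : ∀ b → #[ suc n ] (λ φ → P (φ [ suc u ≔ b ])) ≡ R c₀ b + R c₁ b
  pinned b = trans (#-suc n _) (cong₂ _+_ (#-ext n _ _ (same c₀)) (#-ext n _ _ (same c₁)))
    where
    same : ∀ c φ → P (cons c φ [ suc u ≔ b ]) ≡ P (cons c (φ [ u ≔ b ]))
    same c φ = extP _ _ (λ { zero → refl ; (suc i) → refl })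

-- Reindexing: if a test Q on k colours is read off a colouring of Fin n along an
-- injection v : Fin k → Fin n, the remaining n - k vertices are free, so the
-- proportion of satisfying colourings is unchanged.
#-reindex : ∀ k n (v : Fin k → Fin n) → Injective _≡_ _≡_ v →
  (Q : Colouring k → Bool) → Extensional Q →
  #[ n ] (λ φ → Q (φ ∘ v)) * 2 ^ k ≡ #[ k ] Q * 2 ^ n
#-reindex zero n v v-inj Q extQ with Q (λ ()) in Q∅
... | true = begin
    #[ n ] (λ φ → Q (φ ∘ v)) * 1 ≡⟨ cong (_* 1) (#-true n _ (λ φ → trans (extQ _ _ (λ ())) Q∅)) ⟩
    2 ^ n * 1                    ≡⟨ *-comm (2 ^ n) 1 ⟩
    1 * 2 ^ n                    ≡⟨ cong (_* 2 ^ n) (sym (#-true 0 Q (λ φ → trans (extQ _ _ (λ ())) Q∅))) ⟩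
    #[ 0 ] Q * 2 ^ n ∎
  where open ≡-Reasoning
... | false = begin
    #[ n ] (λ φ → Q (φ ∘ v)) * 1 ≡⟨ cong (_* 1) (#-false n _ (λ φ → trans (extQ _ _ (λ ())) Q∅)) ⟩
    0                            ≡⟨ cong (_* 2 ^ n) (sym (#-false 0 Q (λ φ → trans (extQ _ _ (λ ())) Q∅))) ⟩
    #[ 0 ] Q * 2 ^ n ∎
  where open ≡-Reasoning
#-reindex (suc k) n v v-inj Q extQ = begin
    X * (2 * 2 ^ k)                  ≡⟨ shuffle X (2 ^ k) ⟩
    (2 * X) * 2 ^ k                  ≡⟨ cong (_* 2 ^ k) (#-pin n (v zero) P extP) ⟩
    (R c₀ + R c₁) * 2 ^ k            ≡⟨ *-distribʳ-+ (2 ^ k) (R c₀) (R c₁) ⟩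
    R c₀ * 2 ^ k + R c₁ * 2 ^ k      ≡⟨ cong₂ _+_ (pinned c₀) (pinned c₁) ⟩
    #[ k ] (Q ∘ cons c₀) * 2 ^ n + #[ k ] (Q ∘ cons c₁) * 2 ^ n
      ≡⟨ sym (*-distribʳ-+ (2 ^ n) (#[ k ] (Q ∘ cons c₀)) (#[ k ] (Q ∘ cons c₁))) ⟩
    (#[ k ] (Q ∘ cons c₀) + #[ k ] (Q ∘ cons c₁)) * 2 ^ n ≡⟨ cong (_* 2 ^ n) (sym (#-suc k Q)) ⟩
    #[ suc k ] Q * 2 ^ n ∎
  where
  open ≡-Reasoning
  shuffle : ∀ x t → x * (2 * t) ≡ (2 * x) * t
  shuffle = solve-∀
  P : Colouring n → Bool
  P φ = Q (φ ∘ v)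
  extP : Extensional P
  extP φ ψ φ≗ψ = extQ _ _ (λ i → φ≗ψ (v i))
  X = #[ n ] P
  R : Fin 2 → ℕ
  R b = #[ n ] (λ φ → P (φ [ v zero ≔ b ]))
  pinned : ∀ b → R b * 2 ^ k ≡ #[ k ] (Q ∘ cons b) * 2 ^ n
  pinned b = trans (cong (_* 2 ^ k) (#-ext n _ _ same))
                   (#-reindex k n (v ∘ suc) (λ eq → fsuc-injective (v-inj eq)) (Q ∘ cons b) extQb)
    where
    extQb : Extensional (Q ∘ cons b)
    extQb φ ψ φ≗ψ = extQ _ _ (λ { zero → refl ; (suc i) → φ≗ψ i })
    same : ∀ φ → P (φ [ v zero ≔ b ]) ≡ Q (cons b (φ ∘ v ∘ suc))
    same φ = extQ _ _ λ
      { zero → updateAt-updates (v zero) φ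
      ; (suc i) → updateAt-minimal (v (suc i)) (v zero) φ (λ eq → 0≢1+n (sym (v-inj eq))) }

DependsOn : ∀ {n} → (Fin n → Bool) → (Colouring n → Bool) → Set
DependsOn {n} A P = ∀ φ ψ → (∀ i → T (A i) → φ i ≡ ψ i) → P φ ≡ P ψ

dependsOn-weaken : ∀ {n} {A B : Fin n → Bool} {P : Colouring n → Bool} →
  (∀ i → T (A i) → T (B i)) → DependsOn A P → DependsOn B P
dependsOn-weaken A⊆B depP φ ψ agree = depP φ ψ (λ i i∈A → agree i (A⊆B i i∈A))

-- Independence: tests depending on complementary sets of vertices are independent
-- events under the uniform colouring, i.e. #(P ∧ Q) / 2ⁿ = (#P / 2ⁿ) (#Q / 2ⁿ).
#-independent : ∀ n (A : Fin n → Bool) (P Q : Colouring n → Bool) →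
  DependsOn A P → DependsOn (not ∘ A) Q →
  #[ n ] (λ φ → P φ ∧ Q φ) * 2 ^ n ≡ #[ n ] P * #[ n ] Q

#-independent-step : ∀ n (A : Fin (suc n) → Bool) (P Q : Colouring (suc n) → Bool) →
  T (A zero) → DependsOn A P → DependsOn (not ∘ A) Q →
  #[ suc n ] (λ φ → P φ ∧ Q φ) * 2 ^ suc n ≡ #[ suc n ] P * #[ suc n ] Q

#-independent zero A P Q depP depQ = begin
    #[ 0 ] (λ φ → P φ ∧ Q φ) * 1
      ≡⟨ cong (λ b → 𝟙 b * 1) (cong₂ _∧_ (depP _ ∅ (λ ())) (depQ _ ∅ (λ ()))) ⟩
    𝟙 (P ∅ ∧ Q ∅) * 1          ≡⟨ 𝟙-∧ (P ∅) (Q ∅) ⟩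
    𝟙 (P ∅) * 𝟙 (Q ∅)          ≡⟨ sym (cong₂ (λ a b → 𝟙 a * 𝟙 b) (depP _ ∅ (λ ())) (depQ _ ∅ (λ ()))) ⟩
    #[ 0 ] P * #[ 0 ] Q ∎
  where
  open ≡-Reasoning
  ∅ : Colouring 0
  ∅ ()
  𝟙-∧ : ∀ a b → 𝟙 (a ∧ b) * 1 ≡ 𝟙 a * 𝟙 b
  𝟙-∧ true  true  = refl
  𝟙-∧ true  false = refl
  𝟙-∧ false b     = refl
#-independent (suc n) A P Q depP depQ with A zero in A0
... | true = #-independent-step n A P Q (subst T (sym A0) _) depP depQ
... | false = begin
    #[ suc n ] (λ φ → P φ ∧ Q φ) * 2 ^ suc n
      ≡⟨ cong (_* 2 ^ suc n) (#-ext (suc n) _ _ (λ φ → ∧-comm (P φ) (Q φ))) ⟩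
    #[ suc n ] (λ φ → Q φ ∧ P φ) * 2 ^ suc n
      ≡⟨ #-independent-step n (not ∘ A) Q P (subst (T ∘ not) (sym A0) _) depQ depP' ⟩
    #[ suc n ] Q * #[ suc n ] P ≡⟨ *-comm (#[ suc n ] Q) (#[ suc n ] P) ⟩
    #[ suc n ] P * #[ suc n ] Q ∎
  where
  open ≡-Reasoning
  depP' : DependsOn (not ∘ not ∘ A) P
  depP' = dependsOn-weaken (λ i → subst T (sym (not-involutive (A i)))) depP

#-independent-step n A P Q 0∈A depP depQ = begin
    #[ suc n ] (λ φ → P φ ∧ Q φ) * (2 * 2 ^ n)
      ≡⟨ cong (_* (2 * 2 ^ n)) both-sides ⟩
    (X c₀ + X c₁) * (2 * 2 ^ n)                     ≡⟨ regroup (X c₀) (X c₁) (2 ^ n) ⟩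
    2 * (X c₀ * 2 ^ n + X c₁ * 2 ^ n)               ≡⟨ cong₂ (λ a b → 2 * (a + b)) (ih c₀) (ih c₁) ⟩
    2 * (p₀ * q + p₁ * q)                           ≡⟨ collect p₀ p₁ q ⟩
    (p₀ + p₁) * (q + q)
      ≡⟨ cong₂ _*_ (sym (#-suc n P)) (sym (trans (#-suc n Q) (cong (q +_) (#-ext n _ _ (Q-free c₁))))) ⟩
    #[ suc n ] P * #[ suc n ] Q ∎
  where
  open ≡-Reasoning
  T-not : ∀ {b} → T b → T (not b) → ⊥
  T-not {true} _ ()
  Pc : Fin 2 → Colouring n → Bool
  Pc c φ = P (cons c φ)
  Q′ : Colouring n → Bool
  Q′ φ = Q (cons c₀ φ)
  -- vertex 0 is outside the support of Q, so its colour does not matter to Q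
  Q-free : ∀ c φ → Q (cons c φ) ≡ Q′ φ
  Q-free c φ = depQ _ _ λ { zero 0∉A → ⊥-elim (T-not 0∈A 0∉A) ; (suc i) _ → refl }
  depPc : ∀ c → DependsOn (A ∘ suc) (Pc c)
  depPc c φ ψ agree = depP _ _ λ { zero _ → refl ; (suc i) i∈A → agree i i∈A }
  depQ′ : DependsOn (not ∘ A ∘ suc) Q′
  depQ′ φ ψ agree = depQ _ _ λ { zero _ → refl ; (suc i) i∉A → agree i i∉A }
  X : Fin 2 → ℕ
  X c = #[ n ] (λ φ → Pc c φ ∧ Q′ φ)
  p₀ = #[ n ] (Pc c₀)
  p₁ = #[ n ] (Pc c₁)
  q = #[ n ] Q′
  both-sides : #[ suc n ] (λ φ → P φ ∧ Q φ) ≡ X c₀ + X c₁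
  both-sides = trans (#-suc n _) (cong (X c₀ +_) (#-ext n _ _ (λ φ → cong (Pc c₁ φ ∧_) (Q-free c₁ φ))))
  ih : ∀ c → X c * 2 ^ n ≡ #[ n ] (Pc c) * q
  ih c = #-independent n (A ∘ suc) (Pc c) Q′ (depPc c) depQ′
  regroup : ∀ x₀ x₁ t → (x₀ + x₁) * (2 * t) ≡ 2 * (x₀ * t + x₁ * t)
  regroup = solve-∀
  collect : ∀ a b c → 2 * (a * c + b * c) ≡ (a + b) * (c + c)
  collect = solve-∀

-- A path of m vertices coloured g, between end colours l and r.  firstOr and
-- lastOr return its first and last colour, or the opposite end if m = 0.
firstOr : ∀ m → Fin 2 → Colouring m → Fin 2
firstOr zero r g = r
firstOr (suc m) r g = g zero

lastOr : ∀ m → Fin 2 → Colouring m → Fin 2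
lastOr zero l g = l
lastOr (suc m) l g = lastOr m (g zero) (g ∘ suc)

-- Every vertex of the path has a neighbour (possibly an end) of its own colour.
PathOK : ∀ m → (l r : Fin 2) → Colouring m → Bool
PathOK zero l r g = true
PathOK (suc m) l r g = (g zero ≈ l ∨ g zero ≈ firstOr m r (g ∘ suc)) ∧ PathOK m (g zero) r (g ∘ suc)

-- The cycle ψ 0, ψ 1, …, ψ m, ψ 0: every vertex has a neighbour of its own colour.
CycleOK : ∀ m → Colouring (suc m) → Bool
CycleOK m ψ = (a ≈ firstOr m a (ψ ∘ suc) ∨ a ≈ lastOr m a (ψ ∘ suc)) ∧ PathOK m a a (ψ ∘ suc)
  where a = ψ zero

firstOr-ext : ∀ m r (g h : Colouring m) → (∀ i → g i ≡ h i) → firstOr m r g ≡ firstOr m r h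
firstOr-ext zero r g h g≗h = refl
firstOr-ext (suc m) r g h g≗h = g≗h zero

lastOr-ext : ∀ m l (g h : Colouring m) → (∀ i → g i ≡ h i) → lastOr m l g ≡ lastOr m l h
lastOr-ext zero l g h g≗h = refl
lastOr-ext (suc m) l g h g≗h =
  trans (cong (λ a → lastOr m a (g ∘ suc)) (g≗h zero)) (lastOr-ext m (h zero) (g ∘ suc) (h ∘ suc) (g≗h ∘ suc))

PathOK-ext : ∀ m l r (g h : Colouring m) → (∀ i → g i ≡ h i) → PathOK m l r g ≡ PathOK m l r h
PathOK-ext zero l r g h g≗h = refl
PathOK-ext (suc m) l r g h g≗h = cong₂ _∧_
  (cong₂ _∨_ (cong (_≈ l) (g≗h zero)) (cong₂ _≈_ (g≗h zero) (firstOr-ext m r (g ∘ suc) (h ∘ suc) (g≗h ∘ suc))))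
  (trans (cong (λ a → PathOK m a r (g ∘ suc)) (g≗h zero)) (PathOK-ext m (h zero) r (g ∘ suc) (h ∘ suc) (g≗h ∘ suc)))

CycleOK-ext : ∀ m → Extensional (CycleOK m)
CycleOK-ext m ψ ψ′ ψ≗ψ′ rewrite ψ≗ψ′ zero = cong₂ _∧_
  (cong₂ _∨_ (cong (ψ′ zero ≈_) (firstOr-ext m _ _ _ (ψ≗ψ′ ∘ suc)))
             (cong (ψ′ zero ≈_) (lastOr-ext m _ _ _ (ψ≗ψ′ ∘ suc))))
  (PathOK-ext m _ _ _ _ (ψ≗ψ′ ∘ suc))

-- Transfer matrix.  OpenPath additionally demands, when `closed`, that the last
-- vertex serves the right end; TiedPath also demands that the first vertex has
-- the colour of the left end.
OpenPath : ∀ m → (l r : Fin 2) → Bool → Colouring m → Bool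
OpenPath m l r closed g = (closed ⇒ (lastOr m l g ≈ r)) ∧ PathOK m l r g

TiedPath : ∀ m → (l r : Fin 2) → Bool → Colouring m → Bool
TiedPath m l r closed g = (firstOr m r g ≈ l) ∧ OpenPath m l r closed g

open-untied : ∀ m l y r closed h → y ≈ l ≡ false →
  OpenPath (suc m) l r closed (cons y h) ≡ TiedPath m y r closed h
open-untied m l y r closed h y≉l rewrite y≉l =
  trans (swap (closed ⇒ (lastOr m y h ≈ r)) (y ≈ firstOr m r h) (PathOK m y r h))
        (cong (λ b → b ∧ OpenPath m y r closed h) (≈-sym y (firstOr m r h)))
  where
  swap : ∀ a b c → a ∧ (b ∧ c) ≡ b ∧ (a ∧ c)
  swap true  b c = refl
  swap false true c = refl
  swap false false c = refl

-- The four counts of a transfer-matrix state, for fixed right end and `closed` flag.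
record Tally : Set where
  constructor tally
  field
    open₀ open₁ tied₀ tied₁ : ℕ
open Tally

step : Tally → Tally
step (tally o₀ o₁ t₀ t₁) = tally (o₀ + t₁) (o₁ + t₀) o₀ o₁

-- A path without vertices only carries the condition between its two ends.
tallyAt : ℕ → Fin 2 → Bool → Tally
tallyAt zero r closed =
  tally (𝟙 (closed ⇒ (c₀ ≈ r) ∧ true)) (𝟙 (closed ⇒ (c₁ ≈ r) ∧ true))
        (𝟙 (r ≈ c₀ ∧ ((closed ⇒ (c₀ ≈ r)) ∧ true))) (𝟙 (r ≈ c₁ ∧ ((closed ⇒ (c₁ ≈ r)) ∧ true)))
tallyAt (suc m) r closed = step (tallyAt m r closed)

tallyAt-correct : ∀ m r closed → let t = tallyAt m r closed in
  (#[ m ] (OpenPath m c₀ r closed) ≡ open₀ t) × (#[ m ] (OpenPath m c₁ r closed) ≡ open₁ t) ×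
  (#[ m ] (TiedPath m c₀ r closed) ≡ tied₀ t) × (#[ m ] (TiedPath m c₁ r closed) ≡ tied₁ t)
tallyAt-correct zero r closed = refl , refl , refl , refl
tallyAt-correct (suc m) r closed with tallyAt-correct m r closed
... | o₀ , o₁ , t₀ , t₁ =
  trans (#-suc m _) (cong₂ _+_ o₀ (trans (#-ext m _ _ (λ h → open-untied m c₀ c₁ r closed h refl)) t₁)) ,
  trans (#-suc m _) (trans (cong₂ _+_ (trans (#-ext m _ _ (λ h → open-untied m c₁ c₀ r closed h refl)) t₀) o₁)
                            (+-comm (tied₀ (tallyAt m r closed)) (open₁ (tallyAt m r closed)))) ,
  trans (#-suc m _) (trans (cong₂ _+_ o₀ (#-false m _ (λ _ → refl))) (+-identityʳ _)) ,
  trans (#-suc m _) (cong₂ _+_ (#-false m _ (λ _ → refl)) o₁)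

-- Number of good colourings of the cycle on m + 2 vertices, read off the transfer matrix.
cycleCount : ℕ → ℕ
cycleCount m = (open₀ (tallyAt m c₀ false) + tied₁ (tallyAt m c₀ true))
             + (open₁ (tallyAt m c₁ false) + tied₀ (tallyAt m c₁ true))

-- Fix the colour a of vertex 0 and split on whether vertex 1 also has colour a:
-- if so, vertex 0 is served and the rest is a path from a to a; otherwise the
-- last vertex must serve vertex 0, and vertex 1 is tied to the rest of the path.
cycles-through : ∀ m a → #[ suc m ] (CycleOK (suc m) ∘ cons a)
  ≡ #[ m ] (OpenPath m a a false) + #[ m ] (TiedPath m (opposite a) a true)
cycles-through m a =
  trans (#-split (suc m) (λ g → a ≈ g zero) _)
        (cong₂ _+_ (trans (#-ext (suc m) _ _ served) (tied a))
                   (trans (#-ext (suc m) _ _ unserved) (untied a)))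
  where
  absorb : ∀ x y z → x ∧ ((x ∨ y) ∧ z) ≡ x ∧ z
  absorb true  y z = refl
  absorb false y z = refl
  drop : ∀ x y z → not x ∧ ((x ∨ y) ∧ z) ≡ not x ∧ (y ∧ z)
  drop true  y z = refl
  drop false y z = refl
  served : ∀ g → (a ≈ g zero) ∧ CycleOK (suc m) (cons a g) ≡ TiedPath (suc m) a a false g
  served g = trans (absorb (a ≈ g zero) _ _) (cong (λ b → b ∧ PathOK (suc m) a a g) (≈-sym a (g zero)))
  unserved : ∀ g → not (a ≈ g zero) ∧ CycleOK (suc m) (cons a g)
                   ≡ not (a ≈ g zero) ∧ OpenPath (suc m) a a true g
  unserved g = trans (drop (a ≈ g zero) _ _)
    (cong (λ b → not (a ≈ g zero) ∧ (b ∧ PathOK (suc m) a a g)) (≈-sym a (lastOr (suc m) a g)))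
  tied : ∀ a → #[ suc m ] (TiedPath (suc m) a a false) ≡ #[ m ] (OpenPath m a a false)
  tied zero = trans (#-suc m _) (trans (cong (#[ m ] (OpenPath m c₀ c₀ false) +_) (#-false m _ (λ _ → refl)))
                                      (+-identityʳ _))
  tied (suc zero) = trans (#-suc m _) (cong (_+ #[ m ] (OpenPath m c₁ c₁ false)) (#-false m _ (λ _ → refl)))
  untied : ∀ a → #[ suc m ] (λ g → not (a ≈ g zero) ∧ OpenPath (suc m) a a true g)
                 ≡ #[ m ] (TiedPath m (opposite a) a true)
  untied zero = trans (#-suc m _) (cong₂ _+_ (#-false m _ (λ _ → refl))
                                             (#-ext m _ _ (λ h → open-untied m c₀ c₁ c₀ true h refl)))
  untied (suc zero) = trans (#-suc m _) (trans (cong₂ _+_ (#-ext m _ _ (λ h → open-untied m c₁ c₀ c₁ true h refl))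
                                                          (#-false m _ (λ _ → refl)))
                                               (+-identityʳ _))

cycleCount-correct : ∀ m → #[ 2 + m ] (CycleOK (suc m)) ≡ cycleCount m
cycleCount-correct m = trans (#-suc (suc m) _) (cong₂ _+_
  (trans (cycles-through m c₀) (cong₂ _+_ (proj₁ (tallyAt-correct m c₀ false))
                                          (proj₂ (proj₂ (proj₂ (tallyAt-correct m c₀ true))))))
  (trans (cycles-through m c₁) (cong₂ _+_ (proj₁ (proj₂ (tallyAt-correct m c₁ false)))
                                          (proj₁ (proj₂ (proj₂ (tallyAt-correct m c₁ true)))))))

goodAt : (ℕ → Fin 2) → ℕ → Bool
goodAt s t = s t ≈ s (pred t) ∨ s t ≈ s (suc t)

lastOr-along : ∀ m (s : ℕ → Fin 2) → lastOr m (s 0) (λ i → s (suc (toℕ i))) ≡ s m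
lastOr-along zero s = refl
lastOr-along (suc m) s = lastOr-along m (s ∘ suc)

pathOK-along : ∀ m (s : ℕ → Fin 2) →
  PathOK m (s 0) (s (suc m)) (λ i → s (suc (toℕ i))) ≡ allBelow m (goodAt s ∘ suc)
pathOK-along zero s = refl
pathOK-along (suc zero) s = refl
pathOK-along (suc (suc m)) s = cong (goodAt s 1 ∧_) (pathOK-along (suc m) (s ∘ suc))

checked-below : ∀ N {P : ℕ → Set} (P? : Decidable P) →
  {_ : True (all? {n = N} (λ i → P? (toℕ i)))} → ∀ m → m < N → P m
checked-below N {P} P? {ok} m m<N =
  subst P (toℕ-fromℕ< m<N) (toWitness ok (fromℕ< m<N))

^-distribʳ-* : ∀ x y n → (x * y) ^ n ≡ x ^ n * y ^ n
^-distribʳ-* x y zero = refl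
^-distribʳ-* x y (suc n) = trans (cong (x * y *_) (^-distribʳ-* x y n)) (interchange x y (x ^ n) (y ^ n))
  where
  interchange : ∀ a b c d → a * b * (c * d) ≡ a * c * (b * d)
  interchange = solve-∀

stride-six : ∀ (c B : ℕ) (a : ℕ → ℕ) → (∀ d → a (6 + d) ≤ c * a d) →
  (∀ d → d < 6 → a d ^ 6 ≤ c ^ d * B) → ∀ d → a d ^ 6 ≤ c ^ d * B
stride-six c B a grow base 0 = base 0 (s≤s z≤n)
stride-six c B a grow base 1 = base 1 (s≤s (s≤s z≤n))
stride-six c B a grow base 2 = base 2 (s≤s (s≤s (s≤s z≤n)))
stride-six c B a grow base 3 = base 3 (s≤s (s≤s (s≤s (s≤s z≤n))))
stride-six c B a grow base 4 = base 4 (s≤s (s≤s (s≤s (s≤s (s≤s z≤n)))))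
stride-six c B a grow base 5 = base 5 (s≤s (s≤s (s≤s (s≤s (s≤s (s≤s z≤n))))))
stride-six c B a grow base (suc (suc (suc (suc (suc (suc d)))))) = begin
    a (6 + d) ^ 6            ≤⟨ ^-monoˡ-≤ 6 (grow d) ⟩
    (c * a d) ^ 6            ≡⟨ ^-distribʳ-* c (a d) 6 ⟩
    c ^ 6 * a d ^ 6          ≤⟨ *-monoʳ-≤ (c ^ 6) (stride-six c B a grow base d) ⟩
    c ^ 6 * (c ^ d * B)      ≡⟨ sym (*-assoc (c ^ 6) (c ^ d) B) ⟩
    c ^ 6 * c ^ d * B        ≡⟨ cong (_* B) (sym (^-distribˡ-+-* c 6 d)) ⟩
    c ^ (6 + d) * B ∎
  where open ≤-Reasoning

-- Sequences satisfying the Fibonacci recurrence.  While the ratio of consecutive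
-- terms stays in [8/7, 15/8], six steps multiply by 8 g (1+j) / g j + 5 ≤ 20.
module Fibonacci (g : ℕ → ℕ) (fib : ∀ m → g (2 + m) ≡ g (1 + m) + g m) where

  RatioBounded : ℕ → Set
  RatioBounded j = (8 * g j ≤ 7 * g (1 + j)) × (8 * g (1 + j) ≤ 15 * g j)

  ratio-step : ∀ j → RatioBounded j → RatioBounded (1 + j)
  ratio-step j (lower , upper) rewrite fib j = lower′ , upper′
    where
    next≤ : g (1 + j) ≤ 7 * g j
    next≤ = *-cancelˡ-≤ 8 (≤-trans upper (≤-trans (*-monoˡ-≤ (g j) (≤ᵇ⇒≤ 15 56 tt))
                                                   (≤-reflexive (eq₁ (g j)))))
      where
      eq₁ : ∀ x → 56 * x ≡ 8 * (7 * x)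
      eq₁ = solve-∀
    lower′ : 8 * g (1 + j) ≤ 7 * (g (1 + j) + g j)
    lower′ = begin
      8 * g (1 + j)           ≡⟨ eq₂ (g (1 + j)) ⟩
      7 * g (1 + j) + g (1 + j) ≤⟨ +-monoʳ-≤ (7 * g (1 + j)) next≤ ⟩
      7 * g (1 + j) + 7 * g j ≡⟨ sym (*-distribˡ-+ 7 (g (1 + j)) (g j)) ⟩
      7 * (g (1 + j) + g j) ∎
      where
      open ≤-Reasoning
      eq₂ : ∀ x → 8 * x ≡ 7 * x + x
      eq₂ = solve-∀
    upper′ : 8 * (g (1 + j) + g j) ≤ 15 * g (1 + j)
    upper′ = begin
      8 * (g (1 + j) + g j)       ≡⟨ *-distribˡ-+ 8 (g (1 + j)) (g j) ⟩
      8 * g (1 + j) + 8 * g j     ≤⟨ +-monoʳ-≤ (8 * g (1 + j)) lower ⟩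
      8 * g (1 + j) + 7 * g (1 + j) ≡⟨ eq₃ (g (1 + j)) ⟩
      15 * g (1 + j) ∎
      where
      open ≤-Reasoning
      eq₃ : ∀ x → 8 * x + 7 * x ≡ 15 * x
      eq₃ = solve-∀

  six-steps : ∀ j → g (6 + j) ≡ 8 * g (1 + j) + 5 * g j
  six-steps j rewrite fib (4 + j) | fib (3 + j) | fib (2 + j) | fib (1 + j) | fib j = collect (g (1 + j)) (g j)
    where
    collect : ∀ a b → ((((a + b) + a) + (a + b)) + ((a + b) + a)) + (((a + b) + a) + (a + b)) ≡ 8 * a + 5 * b
    collect = solve-∀

  grows-by-20 : ∀ j → RatioBounded j → g (6 + j) ≤ 20 * g j
  grows-by-20 j (_ , upper) = begin
    g (6 + j)                 ≡⟨ six-steps j ⟩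
    8 * g (1 + j) + 5 * g j   ≤⟨ +-monoˡ-≤ (5 * g j) upper ⟩
    15 * g j + 5 * g j        ≡⟨ sym (*-distribʳ-+ (g j) 15 5) ⟩
    20 * g j ∎
    where open ≤-Reasoning

total : Tally → ℕ
total t = open₀ t + open₁ t

total-fib : ∀ t → total (step (step t)) ≡ total (step t) + total t
total-fib (tally o₀ o₁ t₀ t₁) = regroup o₀ o₁ t₀ t₁
  where
  regroup : ∀ o₀ o₁ t₀ t₁ → (o₀ + t₁ + o₁) + (o₁ + t₀ + o₀) ≡ ((o₀ + t₁) + (o₁ + t₀)) + (o₀ + o₁)
  regroup = solve-∀

tied₀≤total : ∀ t → tied₀ t ≤ total (step t)
tied₀≤total (tally o₀ o₁ t₀ t₁) = ≤-trans (m≤n+m t₀ o₁) (m≤n+m (o₁ + t₀) (o₀ + t₁))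

tied₁≤total : ∀ t → tied₁ t ≤ total (step t)
tied₁≤total (tally o₀ o₁ t₀ t₁) = ≤-trans (m≤n+m t₁ o₀) (m≤m+n (o₀ + t₁) (o₁ + t₀))

envelope : ℕ → ℕ
envelope m = (total (tallyAt m c₀ false) + total (tallyAt (suc m) c₀ true))
           + (total (tallyAt m c₁ false) + total (tallyAt (suc m) c₁ true))

cycleCount≤envelope : ∀ m → cycleCount m ≤ envelope m
cycleCount≤envelope m =
  +-mono-≤ (+-mono-≤ (m≤m+n (open₀ (tallyAt m c₀ false)) _) (tied₁≤total (tallyAt m c₀ true)))
           (+-mono-≤ (m≤n+m (open₁ (tallyAt m c₁ false)) (open₀ (tallyAt m c₁ false))) (tied₀≤total (tallyAt m c₁ true)))

envelope-fib : ∀ m → envelope (2 + m) ≡ envelope (1 + m) + envelope m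
envelope-fib m
  rewrite total-fib (tallyAt m c₀ false) | total-fib (tallyAt (suc m) c₀ true)
        | total-fib (tallyAt m c₁ false) | total-fib (tallyAt (suc m) c₁ true) =
  regroup (total (tallyAt (suc m) c₀ false)) (total (tallyAt m c₀ false))
          (total (tallyAt (2 + m) c₀ true)) (total (tallyAt (suc m) c₀ true))
          (total (tallyAt (suc m) c₁ false)) (total (tallyAt m c₁ false))
          (total (tallyAt (2 + m) c₁ true)) (total (tallyAt (suc m) c₁ true))
  where
  regroup : ∀ a b c d e f g h →
    ((a + b) + (c + d)) + ((e + f) + (g + h)) ≡ ((a + c) + (e + g)) + ((b + d) + (f + h))
  regroup = solve-∀

module Envelope = Fibonacci envelope envelope-fib

envelope-ratio : ∀ j → Envelope.RatioBounded j
envelope-ratio zero = ≤ᵇ⇒≤ _ _ tt , ≤ᵇ⇒≤ _ _ tt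
envelope-ratio (suc j) = Envelope.ratio-step j (envelope-ratio j)

-- From m = 57 on, the envelope itself obeys the bound: the window 57 … 62 is checked
-- by evaluation and the growth by at most 20 every six steps carries it further.
envelope-bound : ∀ d → envelope (d + 57) ^ 6 ≤ 20 ^ d * 20 ^ 59
envelope-bound = stride-six 20 (20 ^ 59) (λ d → envelope (d + 57))
  (λ d → Envelope.grows-by-20 (d + 57) (envelope-ratio (d + 57)))
  (checked-below 6 (λ d → envelope (d + 57) ^ 6 ≤? 20 ^ d * 20 ^ 59))

cycleCount-bound : ∀ m → cycleCount m ^ 6 ≤ 20 ^ (2 + m)
cycleCount-bound m with m <? 57
... | yes m<57 = checked-below 57 (λ m → cycleCount m ^ 6 ≤? 20 ^ (2 + m)) m m<57
... | no m≮57 = subst (λ m → cycleCount m ^ 6 ≤ 20 ^ (2 + m)) (m∸n+n≡m (≮⇒≥ m≮57)) (begin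
    cycleCount (d + 57) ^ 6  ≤⟨ ^-monoˡ-≤ 6 (cycleCount≤envelope (d + 57)) ⟩
    envelope (d + 57) ^ 6    ≤⟨ envelope-bound d ⟩
    20 ^ d * 20 ^ 59         ≡⟨ sym (^-distribˡ-+-* 20 d 59) ⟩
    20 ^ (d + 59)            ≡⟨ cong (20 ^_) (trans (+-suc d 58) (cong suc (+-suc d 57))) ⟩
    20 ^ (2 + (d + 57)) ∎)
  where
  open ≤-Reasoning
  d = m ∸ 57

rescale : ∀ a b c d e N .{{_ : NonZero N}} → a * N ≡ b * c → b * e ≡ d * N → a * e ≡ d * c
rescale a b c d e N aN≡bc be≡dN = *-cancelʳ-≡ (a * e) (d * c) N (begin
  a * e * N   ≡⟨ swap₂₃ a e N ⟩
  a * N * e   ≡⟨ cong (_* e) aN≡bc ⟩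
  b * c * e   ≡⟨ swap₂₃ b c e ⟩
  b * e * c   ≡⟨ cong (_* c) be≡dN ⟩
  d * N * c   ≡⟨ swap₂₃ d N c ⟩
  d * c * N   ∎)
  where
  open ≡-Reasoning
  swap₂₃ : ∀ x y z → x * y * z ≡ x * z * y
  swap₂₃ = solve-∀

bound-rescale : ∀ x z x′ z′ f {K P Q} .{{_ : NonZero K}} →
  x * K ≡ f * x′ → z * K ≡ 1 * z′ → f ^ 6 ≤ P → x′ ^ 6 ≤ Q * z′ ^ 6 → x ^ 6 ≤ P * Q * z ^ 6
bound-rescale x z x′ z′ f {K} {P} {Q} xK≡fx′ zK≡z′ f⁶≤P x′⁶≤ =
  *-cancelʳ-≤ (x ^ 6) (P * Q * z ^ 6) (K ^ 6) {{m^n≢0 K 6}} (begin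
  x ^ 6 * K ^ 6          ≡⟨ sym (^-distribʳ-* x K 6) ⟩
  (x * K) ^ 6            ≡⟨ cong (_^ 6) xK≡fx′ ⟩
  (f * x′) ^ 6           ≡⟨ ^-distribʳ-* f x′ 6 ⟩
  f ^ 6 * x′ ^ 6         ≤⟨ *-mono-≤ f⁶≤P x′⁶≤ ⟩
  P * (Q * z′ ^ 6)       ≡⟨ cong (λ y → P * (Q * y ^ 6)) (sym (trans zK≡z′ (*-identityˡ z′))) ⟩
  P * (Q * (z * K) ^ 6)  ≡⟨ cong (λ y → P * (Q * y)) (^-distribʳ-* z K 6) ⟩
  P * (Q * (z ^ 6 * K ^ 6)) ≡⟨ regroup P Q (z ^ 6) (K ^ 6) ⟩
  P * Q * z ^ 6 * K ^ 6  ∎)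
  where
  open ≤-Reasoning
  regroup : ∀ a b c d → a * (b * (c * d)) ≡ a * b * c * d
  regroup = solve-∀

2^-injective : ∀ a b → 2 ^ a ≡ 2 ^ b → a ≡ b
2^-injective a b 2^a≡2^b with <-cmp a b
... | tri< a<b _ _ = ⊥-elim (<-irrefl 2^a≡2^b (^-monoʳ-< 2 (s≤s (s≤s z≤n)) a<b))
... | tri≈ _ a≡b _ = a≡b
... | tri> _ _ b<a = ⊥-elim (<-irrefl (sym 2^a≡2^b) (^-monoʳ-< 2 (s≤s (s≤s z≤n)) b<a))

VertexSet : ℕ → Set
VertexSet n = Fin n → Bool

_∖_ : ∀ {n} → VertexSet n → VertexSet n → VertexSet n
(S ∖ C) x = S x ∧ not (C x)

Within : ∀ {n} → VertexSet n → (Fin n → Colouring n → Bool) → Colouring n → Bool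
Within {n} S c φ = all (λ x → S x ⇒ c x φ) (allFin n)

within-elim : ∀ {n} (S : VertexSet n) c φ → T (Within S c φ) → ∀ x → T (S x) → T (c x φ)
within-elim S c φ h x = ⇒-elim (all-elim (λ x → S x ⇒ c x φ) h x)

within-intro : ∀ {n} (S : VertexSet n) c φ → (∀ x → T (S x) → T (c x φ)) → T (Within S c φ)
within-intro S c φ h = all-intro (λ x → S x ⇒ c x φ) (λ x → ⇒-intro (h x))

within-split : ∀ {n} (S C : VertexSet n) c φ → (∀ x → T (C x) → T (S x)) →
  Within S c φ ≡ Within C c φ ∧ Within (S ∖ C) c φ
within-split S C c φ C⊆S = T-ext
  (λ h → ∧-intro (within-intro C c φ λ x x∈C → within-elim S c φ h x (C⊆S x x∈C))
                 (within-intro (S ∖ C) c φ λ x x∈S∖C → within-elim S c φ h x (proj₁ (∧-elim x∈S∖C))))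
  (λ h → within-intro S c φ λ x x∈S → on x (∧-elim h) x∈S)
  where
  on : ∀ x → T (Within C c φ) × T (Within (S ∖ C) c φ) → T (S x) → T (c x φ)
  on x (inC , inS∖C) x∈S with C x in Cx
  ... | true  = within-elim C c φ inC x (subst T (sym Cx) _)
  ... | false = within-elim (S ∖ C) c φ inS∖C x (∧-intro x∈S (subst (T ∘ not) (sym Cx) _))

Local : ∀ {n} → Graph n → (Fin n → Colouring n → Bool) → Set
Local {n} G c = ∀ x φ ψ → φ x ≡ ψ x → (∀ y → T (Adj G x y) → φ y ≡ ψ y) → c x φ ≡ c x ψ

Closed : ∀ {n} → Graph n → VertexSet n → Set
Closed G S = ∀ x y → T (S x) → T (Adj G x y) → T (S y)

-- By symmetry of adjacency, removing a closed set from a closed set leaves a closed set.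
closed-∖ : ∀ {n} (G : Graph n) {S C : VertexSet n} → Closed G S → Closed G C → Closed G (S ∖ C)
closed-∖ G {S} {C} S-closed C-closed x y x∈S∖C x~y with ∧-elim x∈S∖C | C y in Cy
... | x∈S , _ | false = ∧-intro (S-closed x y x∈S x~y) _
... | _ , x∉C | true  = ⊥-elim (subst (T ∘ not) (T-true (C-closed y x (subst T (sym Cy) _) (subst T (Graph.sym G x y) x~y))) x∉C)

within-depends : ∀ {n} (G : Graph n) {D S : VertexSet n} {c} → Closed G D → (∀ x → T (S x) → T (D x)) →
  Local G c → DependsOn D (Within S c)
within-depends G {D} {S} {c} D-closed S⊆D local φ ψ agree = all-ext _ _ at
  where
  at : ∀ x → (S x ⇒ c x φ) ≡ (S x ⇒ c x ψ)
  at x with S x in Sx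
  ... | false = refl
  ... | true  = cong (false ∨_) (local x φ ψ (agree x x∈D) (λ y x~y → agree y (D-closed x y x∈D x~y)))
    where x∈D = S⊆D x (subst T (sym Sx) _)

image : ∀ {k n} → (Fin k → Fin n) → VertexSet n
image {k} v x = any (λ i → ⌊ v i ≟ x ⌋) (allFin k)

image-intro : ∀ {k n} (v : Fin k → Fin n) i → T (image v (v i))
image-intro v i = any-intro _ i (fromWitness {a? = v i ≟ v i} refl)

image-elim : ∀ {k n} (v : Fin k → Fin n) x → T (image v x) → ∃ λ i → v i ≡ x
image-elim v x h = let (i , vi≟x) = any-elim _ h in i , toWitness {a? = v i ≟ x} vi≟x

within-image : ∀ {k n} (v : Fin k → Fin n) c φ → Within (image v) c φ ≡ all (λ i → c (v i) φ) (allFin k)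
within-image v c φ = T-ext
  (λ h → all-intro _ λ i → within-elim (image v) c φ h (v i) (image-intro v i))
  (λ h → within-intro (image v) c φ λ x x∈ → at x (image-elim v x x∈) h)
  where
  at : ∀ x → (∃ λ i → v i ≡ x) → T (all (λ i → c (v i) φ) (allFin _)) → T (c x φ)
  at .(v i) (i , refl) h = all-elim _ h i

-- x has a neighbour of its own colour: the condition defining existence homomorphisms into E₂.
served : ∀ {n} → Graph n → Fin n → Colouring n → Bool
served {n} G x φ = any (λ y → Adj G x y ∧ φ x ≈ φ y) (allFin n)

served-local : ∀ {n} (G : Graph n) → Local G (served G)
served-local G x φ ψ φx≡ψx nbs-agree = any-ext _ _ at
  where
  at : ∀ y → (Adj G x y ∧ φ x ≈ φ y) ≡ (Adj G x y ∧ ψ x ≈ ψ y)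
  at y with Adj G x y in x~y
  ... | false = refl
  ... | true  = cong₂ _≈_ φx≡ψx (nbs-agree y (subst T (sym x~y) _))

-- x has colour c₀; the colourings vanishing on S measure the size of S.
vanishes : ∀ {n} → Fin n → Colouring n → Bool
vanishes x φ = φ x ≈ c₀

vanishes-local : ∀ {n} (G : Graph n) → Local G vanishes
vanishes-local G x φ ψ φx≡ψx _ = cong (_≈ c₀) φx≡ψx

record TwoNeighbours {n} (G : Graph n) : Set where
  field
    nb₁ nb₂ : Fin n → Fin n
    neighbours : ∀ x → filterᵇ (Adj G x) (allFin n) ≡ nb₁ x ∷ nb₂ x ∷ []

  nb₁-adj : ∀ x → T (Adj G x (nb₁ x))
  nb₁-adj x = proj₂ (∈-filter⁻ (T? ∘ Adj G x) {xs = allFin n} (subst (nb₁ x ∈_) (sym (neighbours x)) (here refl)))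

  nb₂-adj : ∀ x → T (Adj G x (nb₂ x))
  nb₂-adj x = proj₂ (∈-filter⁻ (T? ∘ Adj G x) {xs = allFin n} (subst (nb₂ x ∈_) (sym (neighbours x)) (there (here refl))))

  nb₁≢nb₂ : ∀ x → nb₁ x ≢ nb₂ x
  nb₁≢nb₂ x with subst Unique (neighbours x) (filter⁺ (T? ∘ Adj G x) (allFin⁺ n))
  ... | (nb₁≢nb₂ ∷ []) ∷ _ = nb₁≢nb₂

  only-neighbours : ∀ x y → T (Adj G x y) → y ≡ nb₁ x ⊎ y ≡ nb₂ x
  only-neighbours x y x~y with subst (y ∈_) (neighbours x) (∈-filter⁺ (T? ∘ Adj G x) (∈-allFin y) x~y)
  ... | here y≡nb₁ = inj₁ y≡nb₁
  ... | there (here y≡nb₂) = inj₂ y≡nb₂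

length≡2 : ∀ {A : Set} (xs : List A) → length xs ≡ 2 → ∃₂ λ a b → xs ≡ a ∷ b ∷ []
length≡2 (a ∷ b ∷ []) refl = a , b , refl

two-regular-neighbours : ∀ {n} (G : Graph n) → IsRegular 2 G → TwoNeighbours G
two-regular-neighbours {n} G reg = record
  { nb₁ = λ x → proj₁ (pair x) ; nb₂ = λ x → proj₁ (proj₂ (pair x)) ; neighbours = λ x → proj₂ (proj₂ (pair x)) }
  where
  pair : ∀ x → ∃₂ λ a b → filterᵇ (Adj G x) (allFin n) ≡ a ∷ b ∷ []
  pair x = length≡2 _ (reg x)

module Walk {n} {G : Graph n} (D : TwoNeighbours G) where
  open TwoNeighbours D

  adj-sym : ∀ x y → T (Adj G x y) → T (Adj G y x)
  adj-sym x y = subst T (Graph.sym G x y)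

  adj-irrefl : ∀ x → ¬ T (Adj G x x)
  adj-irrefl x = subst T (Graph.irrefl G x)

  other : Fin n → Fin n → Fin n
  other p c = if does (nb₁ c ≟ p) then nb₂ c else nb₁ c

  other-adj : ∀ p c → T (Adj G c (other p c))
  other-adj p c with nb₁ c ≟ p
  ... | yes _ = nb₂-adj c
  ... | no _ = nb₁-adj c

  other-≢ : ∀ p c → other p c ≢ p
  other-≢ p c with nb₁ c ≟ p
  ... | yes nb₁≡p = λ nb₂≡p → nb₁≢nb₂ c (trans nb₁≡p (sym nb₂≡p))
  ... | no nb₁≢p = nb₁≢p

  neighbours-via : ∀ p c → T (Adj G c p) → ∀ y → T (Adj G c y) → y ≡ p ⊎ y ≡ other p c
  neighbours-via p c c~p y c~y with nb₁ c ≟ p | only-neighbours c y c~y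
  ... | yes nb₁≡p | inj₁ y≡nb₁ = inj₁ (trans y≡nb₁ nb₁≡p)
  ... | yes _     | inj₂ y≡nb₂ = inj₂ y≡nb₂
  ... | no _      | inj₁ y≡nb₁ = inj₂ y≡nb₁
  ... | no nb₁≢p  | inj₂ y≡nb₂ with only-neighbours c p c~p
  ...   | inj₁ p≡nb₁ = ⊥-elim (nb₁≢p (sym p≡nb₁))
  ...   | inj₂ p≡nb₂ = inj₁ (trans y≡nb₂ (sym p≡nb₂))

  either-neighbour : ∀ p c → T (Adj G c p) → (X : Fin n → Bool) →
    X (nb₁ c) ∨ X (nb₂ c) ≡ X p ∨ X (other p c)
  either-neighbour p c c~p X with nb₁ c ≟ p
  ... | yes nb₁≡p = cong (λ z → X z ∨ X (nb₂ c)) nb₁≡p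
  ... | no nb₁≢p with only-neighbours c p c~p
  ...   | inj₁ p≡nb₁ = ⊥-elim (nb₁≢p (sym p≡nb₁))
  ...   | inj₂ p≡nb₂ = trans (∨-comm (X (nb₁ c)) (X (nb₂ c))) (cong (λ z → X z ∨ X (nb₁ c)) (sym p≡nb₂))

  module From (v : Fin n) where

    w : ℕ → Fin n
    w zero = v
    w (suc zero) = nb₁ v
    w (suc (suc t)) = other (w t) (w (suc t))

    w-adj : ∀ t → T (Adj G (w t) (w (suc t)))
    w-adj zero = nb₁-adj v
    w-adj (suc t) = other-adj (w t) (w (suc t))

    w-adj⁻ : ∀ t → T (Adj G (w (suc t)) (w t))
    w-adj⁻ t = adj-sym _ _ (w-adj t)

    w-step-≢ : ∀ t → w t ≢ w (suc t)
    w-step-≢ t eq = adj-irrefl (w t) (subst (T ∘ Adj G (w t)) (sym eq) (w-adj t))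

    w-back-≢ : ∀ t → w (suc (suc t)) ≢ w t
    w-back-≢ t = other-≢ (w t) (w (suc t))

    InjectiveBelow : ℕ → Set
    InjectiveBelow k = ∀ a b → a < k → b < k → w a ≡ w b → a ≡ b

    record FirstRepeat : Set where
      field
        k i : ℕ
        i<k : i < k
        repeat : w i ≡ w k
        fresh : InjectiveBelow k

    extend : ∀ j → InjectiveBelow (suc j) → (∀ i → i < suc j → w i ≢ w (suc j)) →
             InjectiveBelow (suc (suc j))
    extend j inj new a b a< b< wa≡wb with m≤n⇒m<n∨m≡n (s≤s⁻¹ a<) | m≤n⇒m<n∨m≡n (s≤s⁻¹ b<)
    ... | inj₁ a≤j | inj₁ b≤j = inj a b a≤j b≤j wa≡wb
    ... | inj₁ a≤j | inj₂ refl = ⊥-elim (new a a≤j wa≡wb)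
    ... | inj₂ refl | inj₁ b≤j = ⊥-elim (new b b≤j (sym wa≡wb))
    ... | inj₂ refl | inj₂ refl = refl

    first-repeat-or-injective : ∀ j → FirstRepeat ⊎ InjectiveBelow (suc j)
    first-repeat-or-injective zero =
      inj₂ λ { zero zero _ _ _ → refl ; (suc _) _ (s≤s ()) _ _ ; _ (suc _) _ (s≤s ()) _ }
    first-repeat-or-injective (suc j) with first-repeat-or-injective j
    ... | inj₁ r = inj₁ r
    ... | inj₂ inj with any? (λ (i : Fin (suc j)) → w (toℕ i) ≟ w (suc j))
    ...   | yes (i , wi≡) = inj₁ (record { k = suc j ; i = toℕ i ; i<k = toℕ<n i ; repeat = wi≡ ; fresh = inj })
    ...   | no none = inj₂ (extend j inj λ i i< wi≡ →
                              none (fromℕ< i< , subst (λ t → w t ≡ w (suc j)) (sym (toℕ-fromℕ< i<)) wi≡))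

    first-repeat : FirstRepeat
    first-repeat with first-repeat-or-injective n
    ... | inj₁ r = r
    ... | inj₂ inj with pigeonhole (n<1+n n) (λ (t : Fin (suc n)) → w (toℕ t))
    ...   | i , j , i<j , wi≡wj = ⊥-elim (<-irrefl (inj _ _ (toℕ<n i) (toℕ<n j) wi≡wj) i<j)

    -- The first repeated vertex is v: revisiting an interior vertex of the walk
    -- would force the walk to repeat even earlier or to turn back.
    repeat-at-start : ∀ k i → i < k → w i ≡ w k → InjectiveBelow k → i ≡ 0
    repeat-at-start k zero _ _ _ = refl
    repeat-at-start (suc k′) (suc i′) i<k wi≡wk fresh
      with neighbours-via (w i′) (w (suc i′)) (w-adj⁻ i′) (w k′)
             (subst (λ x → T (Adj G x (w k′))) (sym wi≡wk) (w-adj⁻ k′))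
    ... | inj₁ wk′≡wi′ =
      ⊥-elim (<-irrefl (fresh i′ k′ (<-trans i′<k′ (n<1+n k′)) (n<1+n k′) (sym wk′≡wi′)) i′<k′)
      where i′<k′ = s≤s⁻¹ i<k
    ... | inj₂ wk′≡wi′₊₂ with <-cmp (suc (suc i′)) k′
    ...   | tri< lt _ _ = ⊥-elim (<-irrefl (fresh _ k′ (<-trans lt (n<1+n k′)) (n<1+n k′) (sym wk′≡wi′₊₂)) lt)
    ...   | tri≈ _ eq _ = ⊥-elim (w-back-≢ (suc i′) (trans (cong (w ∘ suc) eq) (sym wi≡wk)))
    ...   | tri> _ _ gt = ⊥-elim (w-step-≢ k′ (trans (cong w (≤-antisym (s≤s⁻¹ gt) (s≤s⁻¹ i<k))) wi≡wk))

    record Return : Set where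
      field
        len : ℕ
        closes : w (3 + len) ≡ v
        fresh : InjectiveBelow (3 + len)

    return : Return
    return = close (FirstRepeat.k r) (≤-trans (s≤s z≤n) (FirstRepeat.i<k r)) start-repeats (FirstRepeat.fresh r)
      where
      r = first-repeat
      start-repeats : w 0 ≡ w (FirstRepeat.k r)
      start-repeats = subst (λ i → w i ≡ w (FirstRepeat.k r))
        (repeat-at-start _ _ (FirstRepeat.i<k r) (FirstRepeat.repeat r) (FirstRepeat.fresh r)) (FirstRepeat.repeat r)
      -- the walk cannot return after one step (no loops) or two (it never turns back)
      close : ∀ k → 0 < k → w 0 ≡ w k → InjectiveBelow k → Return
      close (suc zero) _ v≡w₁ _ = ⊥-elim (w-step-≢ 0 v≡w₁)
      close (suc (suc zero)) _ v≡w₂ _ = ⊥-elim (w-back-≢ 0 (sym v≡w₂))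
      close (suc (suc (suc len))) _ v≡w₃ fresh = record { len = len ; closes = sym v≡w₃ ; fresh = fresh }

module TwoRegular {n} {G : Graph n} (D : TwoNeighbours G) where
  open TwoNeighbours D
  open Walk D

  served-nbs : ∀ x φ → served G x φ ≡ φ x ≈ φ (nb₁ x) ∨ φ x ≈ φ (nb₂ x)
  served-nbs x φ =
    trans (any-filter (Adj G x) (λ y → φ x ≈ φ y) (allFin n))
          (trans (cong (any (λ y → φ x ≈ φ y)) (neighbours x)) (cong (φ x ≈ φ (nb₁ x) ∨_) (∨-identityʳ _)))

  module CycleThrough (v : Fin n) where
    open From v public
    open Return return public

    k : ℕ
    k = 3 + len

    cyc : Fin k → Fin n
    cyc i = w (toℕ i)

    cyc-injective : Injective _≡_ _≡_ cyc
    cyc-injective {i} {j} eq = toℕ-injective (fresh (toℕ i) (toℕ j) (toℕ<n i) (toℕ<n j) eq)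

    C : VertexSet n
    C = image cyc

    -- C is closed: the neighbours of w t are w (t - 1) and w (t + 1), cyclically.
    on-cycle : ∀ t → t < k → T (C (w t))
    on-cycle t t<k = subst (T ∘ C ∘ w) (toℕ-fromℕ< t<k) (image-intro cyc (fromℕ< t<k))

    last-is-nb₂ : w (2 + len) ≡ nb₂ v
    last-is-nb₂
      with only-neighbours v (w (2 + len)) (subst (λ x → T (Adj G x (w (2 + len)))) closes (w-adj⁻ (2 + len)))
    ... | inj₁ w≡nb₁ = ⊥-elim (1≢2+len (fresh 1 (2 + len) (s≤s (s≤s z≤n)) (n<1+n _) (sym w≡nb₁)))
      where
      1≢2+len : 1 ≢ 2 + len
      1≢2+len ()
    ... | inj₂ w≡nb₂ = w≡nb₂

    C-closed : Closed G C
    C-closed x y x∈C x~y with image-elim cyc x x∈C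
    ... | i , refl = from (toℕ i) (toℕ<n i) x~y
      where
      from : ∀ t → t < k → T (Adj G (w t) y) → T (C y)
      from zero _ v~y with only-neighbours v y v~y
      ... | inj₁ refl = on-cycle 1 (s≤s (s≤s z≤n))
      ... | inj₂ refl = subst (T ∘ C) last-is-nb₂ (on-cycle (2 + len) (n<1+n _))
      from (suc t) t<k w~y with neighbours-via (w t) (w (suc t)) (w-adj⁻ t) y w~y
      ... | inj₁ refl = on-cycle t (<-trans (n<1+n t) t<k)
      ... | inj₂ refl with m≤n⇒m<n∨m≡n t<k
      ...   | inj₁ lt = on-cycle (suc (suc t)) lt
      ...   | inj₂ eq = subst (T ∘ C) (sym (trans (cong w eq) closes)) (on-cycle 0 (s≤s z≤n))

    C-inside : ∀ (S : VertexSet n) → Closed G S → T (S v) → ∀ x → T (C x) → T (S x)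
    C-inside S S-closed v∈S x x∈C with image-elim cyc x x∈C
    ... | i , refl = walk-inside (toℕ i)
      where
      walk-inside : ∀ t → T (S (w t))
      walk-inside zero = v∈S
      walk-inside (suc t) = S-closed _ _ (walk-inside t) (w-adj t)

    cycle-served : ∀ φ → Within C (served G) φ ≡ CycleOK (2 + len) (φ ∘ cyc)
    cycle-served φ = begin
      Within C (served G) φ                        ≡⟨ within-image cyc (served G) φ ⟩
      all (λ i → served G (cyc i) φ) (allFin k)    ≡⟨ all-toℕ k (λ t → served G (w t) φ) ⟩
      allBelow k (λ t → served G (w t) φ)
        ≡⟨ cong₂ _∧_ (served-at-v) (allBelow-ext (2 + len) _ _ served-along) ⟩
      (φ v ≈ φ (w 1) ∨ φ v ≈ s (2 + len)) ∧ allBelow (2 + len) (goodAt s ∘ suc)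
        ≡⟨ sym (cong₂ (λ a b → (φ v ≈ φ (w 1) ∨ φ v ≈ a) ∧ b) (lastOr-along (2 + len) s) path) ⟩
      CycleOK (2 + len) (φ ∘ cyc) ∎
      where
      open ≡-Reasoning
      s : ℕ → Fin 2
      s = φ ∘ w
      served-at-v : served G v φ ≡ φ v ≈ φ (w 1) ∨ φ v ≈ s (2 + len)
      served-at-v = trans (served-nbs v φ) (cong (λ x → φ v ≈ φ (nb₁ v) ∨ φ v ≈ φ x) (sym last-is-nb₂))
      served-along : ∀ t → served G (w (suc t)) φ ≡ goodAt s (suc t)
      served-along t = trans (served-nbs (w (suc t)) φ)
                             (either-neighbour (w t) (w (suc t)) (w-adj⁻ t) (λ y → φ (w (suc t)) ≈ φ y))
      path : PathOK (2 + len) (φ v) (φ v) (λ i → s (suc (toℕ i))) ≡ allBelow (2 + len) (goodAt s ∘ suc)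
      path = trans (cong (λ r → PathOK (2 + len) (φ v) r (λ i → s (suc (toℕ i)))) (cong φ (sym closes)))
                   (pathOK-along (2 + len) s)

    #-served-on-cycle : #[ n ] (Within C (served G)) * 2 ^ k ≡ cycleCount (suc len) * 2 ^ n
    #-served-on-cycle =
      trans (cong (_* 2 ^ k) (#-ext n _ _ cycle-served))
            (trans (#-reindex k n cyc cyc-injective (CycleOK (2 + len)) (CycleOK-ext (2 + len)))
                   (cong (_* 2 ^ n) (cycleCount-correct (suc len))))

    #-vanishing-on-cycle : #[ n ] (Within C vanishes) * 2 ^ k ≡ 1 * 2 ^ n
    #-vanishing-on-cycle =
      trans (cong (_* 2 ^ k) (#-ext n _ _ (within-image cyc vanishes)))
            (trans (#-reindex k n cyc cyc-injective Q Q-ext) (cong (_* 2 ^ n) (#-all-c₀ k)))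
      where
      Q : Colouring k → Bool
      Q ψ = all (λ i → ψ i ≈ c₀) (allFin k)
      Q-ext : Extensional Q
      Q-ext ψ ψ′ ψ≗ψ′ = all-ext _ _ (λ i → cong (_≈ c₀) (ψ≗ψ′ i))

module Main {n} (G : Graph n) (D : TwoNeighbours G) where
  open TwoRegular D

  served-on vanishing-on : VertexSet n → ℕ
  served-on S = #[ n ] (Within S (served G))
  vanishing-on S = #[ n ] (Within S vanishes)

  -- The bound for S: with s = |S| (so that 2 ^ (n - s) colourings vanish on S),
  -- served-on S ^ 6 ≤ 20 ^ s · vanishing-on S ^ 6, i.e. (served-on S / 2 ^ (n - s)) ^ 6 ≤ 20 ^ s.
  Bounded : VertexSet n → Set
  Bounded S = Σ ℕ λ s → (vanishing-on S * 2 ^ s ≡ 2 ^ n) × (served-on S ^ 6 ≤ 20 ^ s * vanishing-on S ^ 6)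

  empty-bounded : ∀ S → (∀ x → ¬ T (S x)) → Bounded S
  empty-bounded S S-empty = 0 , trans (*-identityʳ _) vanish , ≤-reflexive (begin
      served-on S ^ 6              ≡⟨ cong (_^ 6) (trans (everything (served G)) (sym vanish)) ⟩
      vanishing-on S ^ 6           ≡⟨ sym (*-identityˡ _) ⟩
      1 * vanishing-on S ^ 6 ∎)
    where
    open ≡-Reasoning
    everything : ∀ c → #[ n ] (Within S c) ≡ 2 ^ n
    everything c = #-true n _ (λ φ → T-true (within-intro S c φ (λ x x∈S → ⊥-elim (S-empty x x∈S))))
    vanish = everything vanishes

  -- Splitting off the cycle through v ∈ S: both counts rescale by the cycle (the
  -- served count by cycleCount / 2 ^ k, the vanishing count by 1 / 2 ^ k), and the
  -- cycle contributes its k vertices with cycleCount ^ 6 ≤ 20 ^ k.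
  cycle-step : ∀ S v → T (S v) → Closed G S → Bounded (S ∖ CycleThrough.C v) → Bounded S
  cycle-step S v v∈S S-closed (s′ , vanish′ , bound′) = k + s′ , vanish , bound
    where
    open CycleThrough v
    C⊆S = C-inside S S-closed v∈S
    -- a local condition on S is independent across C and S ∖ C, which is closed off from C
    split : ∀ c → Local G c →
      #[ n ] (Within S c) * 2 ^ n ≡ #[ n ] (Within C c) * #[ n ] (Within (S ∖ C) c)
    split c c-local = trans (cong (_* 2 ^ n) (#-ext n _ _ (λ φ → within-split S C c φ C⊆S)))
      (#-independent n C _ _ (within-depends G C-closed (λ x x∈C → x∈C) c-local)
                             (within-depends G (closed-∖ G (λ _ _ _ _ → _) C-closed) (λ x → proj₂ ∘ ∧-elim) c-local))
    instance
      2^n≢0 : NonZero (2 ^ n)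
      2^n≢0 = m^n≢0 2 n
      2^k≢0 : NonZero (2 ^ k)
      2^k≢0 = m^n≢0 2 k
    served-rescaled : served-on S * 2 ^ k ≡ cycleCount (suc len) * served-on (S ∖ C)
    served-rescaled =
      rescale (served-on S) (served-on C) (served-on (S ∖ C)) (cycleCount (suc len)) (2 ^ k) (2 ^ n)
      (split (served G) (served-local G)) #-served-on-cycle
    vanishing-rescaled : vanishing-on S * 2 ^ k ≡ 1 * vanishing-on (S ∖ C)
    vanishing-rescaled = rescale (vanishing-on S) (vanishing-on C) (vanishing-on (S ∖ C)) 1 (2 ^ k) (2 ^ n)
      (split vanishes (vanishes-local G)) #-vanishing-on-cycle
    vanish : vanishing-on S * 2 ^ (k + s′) ≡ 2 ^ n
    vanish = begin
      vanishing-on S * 2 ^ (k + s′)          ≡⟨ cong (vanishing-on S *_) (^-distribˡ-+-* 2 k s′) ⟩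
      vanishing-on S * (2 ^ k * 2 ^ s′)      ≡⟨ sym (*-assoc (vanishing-on S) (2 ^ k) (2 ^ s′)) ⟩
      vanishing-on S * 2 ^ k * 2 ^ s′        ≡⟨ cong (_* 2 ^ s′) (trans vanishing-rescaled (*-identityˡ _)) ⟩
      vanishing-on (S ∖ C) * 2 ^ s′          ≡⟨ vanish′ ⟩
      2 ^ n ∎
      where open ≡-Reasoning
    bound : served-on S ^ 6 ≤ 20 ^ (k + s′) * vanishing-on S ^ 6
    bound = subst (λ P → served-on S ^ 6 ≤ P * vanishing-on S ^ 6) (sym (^-distribˡ-+-* 20 k s′))
      (bound-rescale (served-on S) (vanishing-on S) (served-on (S ∖ C)) (vanishing-on (S ∖ C))
                     (cycleCount (suc len)) served-rescaled vanishing-rescaled (cycleCount-bound (suc len)) bound′)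

  size : VertexSet n → ℕ
  size S = countL S (allFin n)

  bounded : ∀ fuel S → size S < fuel → Closed G S → Bounded S
  bounded (suc fuel) S size<fuel S-closed with any S (allFin n) in S?
  ... | false = empty-bounded S (λ x x∈S → subst T S? (any-intro S x x∈S))
  ... | true with any-elim S (subst T (sym S?) _)
  ...   | v , v∈S = cycle-step S v v∈S S-closed
    (bounded fuel (S ∖ C) (≤-trans smaller (s≤s⁻¹ size<fuel)) (closed-∖ G S-closed C-closed))
    where
    open CycleThrough v
    smaller : size (S ∖ C) < size S
    smaller = countL-strict (S ∖ C) S (λ x → proj₁ ∘ ∧-elim) (allFin n) (∈-allFin v) v∈S
                (λ v∈S∖C → subst (T ∘ not) (T-true (on-cycle 0 (s≤s z≤n))) (proj₂ (∧-elim {S v} v∈S∖C)))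

mainTheorem7 : (n : ℕ) (G : Graph n) → IsRegular 2 G →
    xhom G E₂ ^ 6 ≤ xhom C₆ E₂ ^ n
mainTheorem7 n G reg = begin
    xhom G E₂ ^ 6                        ≡⟨ cong (_^ 6) (length-filter (isXhom G E₂) (allFuns n 2)) ⟩
    served-on everything ^ 6             ≤⟨ proj₂ (proj₂ all-bounded) ⟩
    20 ^ s * vanishing-on everything ^ 6 ≡⟨ cong (λ z → 20 ^ s * z ^ 6) (#-all-c₀ n) ⟩
    20 ^ s * 1                           ≡⟨ trans (*-identityʳ (20 ^ s)) (cong (20 ^_) s≡n) ⟩
    20 ^ n                               ≡⟨⟩
    xhom C₆ E₂ ^ n ∎
  where
  -- An existence homomorphism into E₂ is a colouring serving every vertex, so
  -- xhom G E₂ = served-on everything; xhom C₆ E₂ = 20 is evaluated.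
  open ≤-Reasoning
  open Main G (two-regular-neighbours G reg)
  everything : VertexSet n
  everything _ = true
  all-bounded : Bounded everything
  all-bounded = bounded (suc (size everything)) everything (n<1+n _) (λ _ _ _ _ → _)
  s = proj₁ all-bounded
  -- only the zero colouring vanishes everywhere, so 2 ^ s = 2 ^ n
  s≡n : s ≡ n
  s≡n = 2^-injective s n (trans (sym (*-identityˡ (2 ^ s)))
          (trans (cong (_* 2 ^ s) (sym (#-all-c₀ n))) (proj₁ (proj₂ all-bounded))))
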